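{- Let $\mathcal{G}=(V,V_\exists,\to,\mathcal{T})$ be a reachability game and $\mathcal{L}(\mathcal{G})$ the LTS defined below. For every $s\in V$ and every relation $\rho$ on the states of $\mathcal{L}(\mathcal{G})$ with $\sim\subseteq\rho\subseteq\preceq$ (bisimulation equivalence and simulation preorder on $\mathcal{L}(\mathcal{G})$): (a) if $s\in W_E$ then $s\not\preceq s'$ and hence $(s,s')\notin\rho$; (b) if $s\notin W_E$ then $s\sim s'$ and hence $(s,s')\in\rho$.
   Context: A reachability game $\mathcal{G}=(V,V_\exists,\to,\mathcal{T})$ has states $V$ (arbitrary set), Eve's states $V_\exists\subseteq V$, Adam's states $V_\forall=V\setminus V_\exists$, transitions $\to\subseteq V\times V$, targets $\mathcal{T}\subseteq V$. Eve's winning area $W_E$ is the least set $W\subseteq V$ with $\mathcal{T}\subseteq W$, containing each $s\in V_\exists$ with some successor in $W$ and each $s\in V_\forall$ whose successor set is nonempty and contained in $W$. Simulation preorder $\preceq$ and bisimulation equivalence $\sim$ on an LTS are the unions of all simulations and all bisimulations respectively (standard definitions). The LTS $\mathcal{L}(\mathcal{G})$: let $V'=\{s'\mid s\in V\}$ be a disjoint copy of $V$. States: $V\cup V'\cup\{\langle s,\bar s\rangle\mid s\in V_\forall, s\to\bar s\}\cup\{\langle s,X\rangle\mid s\in V_\forall, X=\{\bar s\mid s\to\bar s\}\neq\emptyset\}$. Actions: $a_c$, $a_{win}$, and $a_{\langle s,\bar s\rangle}$ for each transition $s\to\bar s$. Transitions are exactly: for $s\in V_\exists$ and $s\to\bar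 s$: $s\xrightarrow{a_{\langle s,\bar s\rangle}}\bar s$ and $s'\xrightarrow{a_{\langle s,\bar s\rangle}}\bar s'$; for $s\in V_\forall$ with $X=\{\bar s\mid s\to\bar s\}\neq\emptyset$: $s\xrightarrow{a_c}\langle s,X\rangle$, and for each $\bar s\in X$: $s\xrightarrow{a_c}\langle s,\bar s\rangle$, $s'\xrightarrow{a_c}\langle s,\bar s\rangle$, $\langle s,X\rangle\xrightarrow{a_{\langle s,\bar s\rangle}}\bar s$, $\langle s,\bar s\rangle\xrightarrow{a_{\langle s,\bar s\rangle}}\bar s'$, and $\langle s,\bar s\rangle\xrightarrow{a_{\langle s,\bar{\bar s}\rangle}}\bar{\bar s}$ for each $\bar{\bar s}\in X\setminus\{\bar s\}$; for each $s\in\mathcal{T}$: $s\xrightarrow{a_{win}}s$. -}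

module Defs where

open import Data.Product using (Σ; ∃; _×_; _,_)
open import Relation.Nullary using (¬_)
open import Relation.Binary.PropositionalEquality using (_≡_; _≢_)

record Game : Set₁ where
  field
    V      : Set
    Eve    : V → Set
    _⟶_    : V → V → Set
    Target : V → Set

module _ (G : Game) where
  open Game G

  Adam : V → Set
  Adam s = ¬ Eve s

  data Win : V → Set where
    win-target : ∀ {s} → Target s → Win s
    win-eve    : ∀ {s t} → Eve s → s ⟶ t → Win t → Win s
    win-adam   : ∀ {s} → Adam s → (∃ λ t → s ⟶ t) → (∀ t → s ⟶ t → Win t) → Win s

  data St : Set where
    orig : V → St
    copy : V → St
    edge : (s t : V) → Adam s → s ⟶ t → St
    full : (s : V) → Adam s → (∃ λ t → s ⟶ t) → St

  data Act : Set where
    a-c   : Act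
    a-win : Act
    a-tr  : V → V → Act

  data Step : St → Act → St → Set where
    eve-orig   : ∀ {s t} → Eve s → s ⟶ t → Step (orig s) (a-tr s t) (orig t)
    eve-copy   : ∀ {s t} → Eve s → s ⟶ t → Step (copy s) (a-tr s t) (copy t)
    adam-full  : ∀ {s} (a : Adam s) (ne : ∃ λ t → s ⟶ t) →
                 Step (orig s) a-c (full s a ne)
    adam-orig  : ∀ {s t} (a : Adam s) (e : s ⟶ t) → Step (orig s) a-c (edge s t a e)
    adam-copy  : ∀ {s t} (a : Adam s) (e : s ⟶ t) → Step (copy s) a-c (edge s t a e)
    full-out   : ∀ {s t} {a : Adam s} {ne : ∃ λ u → s ⟶ u} → s ⟶ t →
                 Step (full s a ne) (a-tr s t) (orig t)
    edge-self  : ∀ {s t} {a : Adam s} {e : s ⟶ t} →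
                 Step (edge s t a e) (a-tr s t) (copy t)
    edge-other : ∀ {s t u} {a : Adam s} {e : s ⟶ t} → s ⟶ u → u ≢ t →
                 Step (edge s t a e) (a-tr s u) (orig u)
    target-win : ∀ {s} → Target s → Step (orig s) a-win (orig s)

  IsSimulation : (St → St → Set) → Set
  IsSimulation R = ∀ {p q p′ α} → R p q → Step p α p′ →
                   ∃ λ q′ → Step q α q′ × R p′ q′

  IsBisimulation : (St → St → Set) → Set
  IsBisimulation R = IsSimulation R × IsSimulation (λ p q → R q p)

  _≼_ : St → St → Set₁
  p ≼ q = Σ (St → St → Set) λ R → IsSimulation R × R p q

  _∼_ : St → St → Set₁
  p ∼ q = Σ (St → St → Set) λ R → IsBisimulation R × R p q

module Submission where

-- If Eve wins from s, any simulation relating s to s′ is dragged along a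
-- play following her winning strategy: s′ copies Eve's moves, and when Adam
-- moves, s →a_c ⟨s,X⟩ can only be answered by some ⟨s,s̄⟩, whose one reply
-- to the action a⟨s,s̄⟩ is s̄′, so s̄ and s̄′ are related again.  The play
-- reaches a target, where a_win cannot be matched by a primed state.
-- If Eve loses from s, relate t with t′ for every losing t, and ⟨t,X⟩ with
-- ⟨t,t̄⟩ for a losing successor t̄ (which exists classically); together
-- with the identity this is a bisimulation.

open import Defs
open import Level using (Level; 0ℓ)
open import Data.Product using (_×_; _,_; ∃)
open import Relation.Nullary using (¬_; yes; no)
open import Relation.Binary.PropositionalEquality using (_≡_; refl)
open import Axiom.ExcludedMiddle using (ExcludedMiddle)
open import Axiom.DoubleNegationElimination using (DoubleNegationElimination; em⇒dne)

¬∀⇒∃¬ : ∀ {ℓ} → DoubleNegationElimination ℓ → {A : Set ℓ} {P Q : A → Set ℓ} →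
        ¬ (∀ x → P x → Q x) → ∃ λ x → P x × ¬ Q x
¬∀⇒∃¬ dne ¬∀ = dne λ ¬∃ → ¬∀ λ x px → dne λ ¬qx → ¬∃ (x , px , ¬qx)

module _ (G : Game) where
  open Game G

  win⇒¬simulated : ∀ {s} → Win G s → (R : St G → St G → Set) → IsSimulation G R →
                   ¬ R (orig s) (copy s)
  win⇒¬simulated (win-target t) R sim r with sim r (target-win t)
  ... | _ , () , _
  win⇒¬simulated (win-eve ev e w) R sim r with sim r (eve-orig ev e)
  ... | _ , eve-copy _ _ , r′ = win⇒¬simulated w R sim r′
  win⇒¬simulated (win-adam a ne ws) R sim r with sim r (adam-full a ne)
  ... | _ , adam-copy _ e , r′ with sim r′ (full-out e)
  ... | _ , edge-self , r″ = win⇒¬simulated (ws _ e) R sim r″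
  ... | _ , edge-other _ u≢t , _ = u≢t refl

  win⇒orig⋠copy : ∀ {s} → Win G s → ¬ _≼_ G (orig s) (copy s)
  win⇒orig⋠copy w (R , sim , r) = win⇒¬simulated w R sim r

  adam-losing-move : DoubleNegationElimination 0ℓ → ∀ {s} → Adam G s →
                     (∃ λ t → s ⟶ t) → ¬ Win G s → ∃ λ t → (s ⟶ t) × ¬ Win G t
  adam-losing-move dne a ne ¬w = ¬∀⇒∃¬ dne (λ ws → ¬w (win-adam a ne ws))

  data Mirror : St G → St G → Set where
    same      : ∀ p → Mirror p p
    orig-copy : ∀ {s} → ¬ Win G s → Mirror (orig s) (copy s)
    full-edge : ∀ {s t a ne e} → ¬ Win G t → Mirror (full s a ne) (edge s t a e)

  module _ (em : ExcludedMiddle 0ℓ) where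

    Mirror-simulation : IsSimulation G Mirror
    Mirror-simulation (same _) step = _ , step , same _
    Mirror-simulation (orig-copy ¬w) (eve-orig ev e) =
      _ , eve-copy ev e , orig-copy (λ w → ¬w (win-eve ev e w))
    Mirror-simulation (orig-copy ¬w) (adam-full a ne) with adam-losing-move (em⇒dne em) a ne ¬w
    ... | _ , e , ¬wt = _ , adam-copy a e , full-edge ¬wt
    Mirror-simulation (orig-copy _) (adam-orig a e) = _ , adam-copy a e , same _
    Mirror-simulation (orig-copy ¬w) (target-win t) with ¬w (win-target t)
    ... | ()
    Mirror-simulation (full-edge {t = t} ¬wt) (full-out {t = u} e) with em {u ≡ t}
    ... | yes refl = _ , edge-self , orig-copy ¬wt
    ... | no u≢t = _ , edge-other e u≢t , same _

    Mirror-simulation⁻¹ : IsSimulation G (λ p q → Mirror q p)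
    Mirror-simulation⁻¹ (same _) step = _ , step , same _
    Mirror-simulation⁻¹ (orig-copy ¬w) (eve-copy ev e) =
      _ , eve-orig ev e , orig-copy (λ w → ¬w (win-eve ev e w))
    Mirror-simulation⁻¹ (orig-copy _) (adam-copy a e) = _ , adam-orig a e , same _
    Mirror-simulation⁻¹ (full-edge {e = e} ¬wt) edge-self = _ , full-out e , orig-copy ¬wt
    Mirror-simulation⁻¹ (full-edge _) (edge-other e _) = _ , full-out e , same _

    Mirror-bisimulation : IsBisimulation G Mirror
    Mirror-bisimulation = Mirror-simulation , Mirror-simulation⁻¹

    ¬win⇒orig∼copy : ∀ {s} → ¬ Win G s → _∼_ G (orig s) (copy s)
    ¬win⇒orig∼copy ¬w = Mirror , Mirror-bisimulation , orig-copy ¬w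

lemma2 : ∀ {ℓ : Level} (G : Game) (ρ : St G → St G → Set ℓ) →
         (∀ {p q} → _∼_ G p q → ρ p q) →
         (∀ {p q} → ρ p q → _≼_ G p q) →
         (s : Game.V G) →
         (Win G s → ¬ _≼_ G (orig s) (copy s) × ¬ ρ (orig s) (copy s))
         × (ExcludedMiddle 0ℓ → ¬ Win G s → _∼_ G (orig s) (copy s) × ρ (orig s) (copy s))
lemma2 G ρ ∼⊆ρ ρ⊆≼ s = winning , losing
  where
  winning : Win G s → ¬ _≼_ G (orig s) (copy s) × ¬ ρ (orig s) (copy s)
  winning w = win⇒orig⋠copy G w , λ r → win⇒orig⋠copy G w (ρ⊆≼ r)

  losing : ExcludedMiddle 0ℓ → ¬ Win G s → _∼_ G (orig s) (copy s) × ρ (orig s) (copy s)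
  losing em ¬w = ¬win⇒orig∼copy G em ¬w , ∼⊆ρ (¬win⇒orig∼copy G em ¬w)
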